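{- For a positive integer $n$, let $H_n$ be the number of DNA strings $x$ of weight $n$ with $x=\bar{x}$. Then $H_n=0$ if $n$ is odd, and $H_n=G_{n/2}$ if $n$ is even.
   Context: A DNA string is a nonempty finite string over $\{\mathtt{A},\mathtt{C},\mathtt{T},\mathtt{G}\}$. The Watson–Crick complement pairs are $\mathtt{A}\leftrightarrow\mathtt{T}$ and $\mathtt{C}\leftrightarrow\mathtt{G}$. The complement of $x=a_1\cdots a_k$ is $\bar{x}=b_1\cdots b_k$ where $b_i$ is the Watson–Crick complement of $a_{k-i+1}$. The weight is $w(x)=\sum_i w(a_i)$ with $w(\mathtt{A})=w(\mathtt{T})=1$, $w(\mathtt{C})=w(\mathtt{G})=2$. For $m\ge 1$, $G_m$ is the number of DNA strings of weight exactly $m$ (so $G_1=2$, $G_2=6$, $G_m=2G_{m-1}+2G_{m-2}$ for $m\ge 3$). -}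

module Defs where

open import Data.Nat using (ℕ; zero; suc; _+_; _*_)
open import Data.List using (List; []; _∷_; length; reverse; map; filter; concat; concatMap; _++_)
open import Data.Product using (_×_; _,_)
open import Relation.Binary.PropositionalEquality using (_≡_)
open import Relation.Nullary using (Dec; yes; no)
open import Relation.Nullary.Decidable using (_×-dec_)
import Data.Nat.Properties as ℕP
open import Data.List.Properties using (≡-dec)

data Base : Set where
  A C T G : Base

_≟B_ : (x y : Base) → Dec (x ≡ y)
A ≟B A = yes _≡_.refl
C ≟B C = yes _≡_.refl
T ≟B T = yes _≡_.refl
G ≟B G = yes _≡_.refl
A ≟B C = no (λ ())
A ≟B T = no (λ ())
A ≟B G = no (λ ())
C ≟B A = no (λ ())
C ≟B T = no (λ ())
C ≟B G = no (λ ())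
T ≟B A = no (λ ())
T ≟B C = no (λ ())
T ≟B G = no (λ ())
G ≟B A = no (λ ())
G ≟B C = no (λ ())
G ≟B T = no (λ ())

comp : Base → Base
comp A = T
comp T = A
comp C = G
comp G = C

wB : Base → ℕ
wB A = 1
wB T = 1
wB C = 2
wB G = 2

weight : List Base → ℕ
weight [] = 0
weight (b ∷ x) = wB b + weight x

bar : List Base → List Base
bar x = map comp (reverse x)

stringsOfLength : ℕ → List (List Base)
stringsOfLength zero = [] ∷ []
stringsOfLength (suc k) =
  concatMap (λ x → (A ∷ x) ∷ (C ∷ x) ∷ (T ∷ x) ∷ (G ∷ x) ∷ []) (stringsOfLength k)

stringsUpTo : ℕ → List (List Base)
stringsUpTo zero = stringsOfLength zero
stringsUpTo (suc k) = stringsUpTo k ++ stringsOfLength (suc k)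

-- DNA strings of weight exactly n (n ≥ 1); every such string has length ≤ n,
-- so it suffices to filter the strings of length ≤ n
stringsOfWeight : ℕ → List (List Base)
stringsOfWeight n = filter (λ x → weight x ℕP.≟ n) (stringsUpTo n)

Gcount : ℕ → ℕ
Gcount n = length (stringsOfWeight n)

H : ℕ → ℕ
H n = length (filter (λ x → ≡-dec _≟B_ x (bar x)) (stringsOfWeight n))

-- A self-complementary string of length 2j is y ++ bar y for its first half y, and
-- one of odd length is impossible because its middle letter would be its own
-- complement. Peeling off the first and last letters, which must be complementary,
-- turns this into a count: self-complementary strings of length 2j correspond to
-- arbitrary strings of length j via y ↦ y ++ bar y. Since this map doubles the
-- weight, there are none of odd weight, and those of weight 2m correspond to the
-- strings of weight m.
module Submission where

open import Defs
open import Algebra.Properties.CommutativeSemigroup using (interchange)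
open import Data.Bool using (Bool; true; false; _∧_; if_then_else_)
open import Data.Bool.Properties using (∧-assoc; ∧-zeroʳ; ∧-identityʳ)
open import Data.List using (List; []; _∷_; _++_; _∷ʳ_; [_]; map; reverse; filter; length; concatMap)
open import Data.List.Properties
  using (map-++; map-cong; unfold-reverse; reverse-++; ++-assoc; ∷-injective; ∷ʳ-injective; ≡-dec)
open import Data.Nat using (ℕ; suc; _*_; _+_)
open import Data.Nat.ListAction using (sum)
open import Data.Nat.ListAction.Properties using (sum-++)
open import Data.Nat.Properties
  using (_≟_; +-identityʳ; +-assoc; +-comm; *-suc; *-cancelˡ-≡; even≢odd; +-commutativeSemigroup)
open import Data.Product using (_×_; _,_; proj₁)
open import Function using (_∘_; _⇔_; mk⇔)
open import Relation.Nullary using (Dec; does; _×-dec_)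
open import Relation.Nullary.Decidable using (does-⇔; dec-false)
open import Relation.Binary.PropositionalEquality
  using (_≡_; refl; sym; trans; cong; cong₂; module ≡-Reasoning)
open ≡-Reasoning

private variable X Y : Set

∑ : List X → (X → ℕ) → ℕ
∑ xs f = sum (map f xs)

∑-cong : {f g : X → ℕ} → (∀ x → f x ≡ g x) → ∀ xs → ∑ xs f ≡ ∑ xs g
∑-cong f≗g xs = cong sum (map-cong f≗g xs)

∑-zero : (xs : List X) → ∑ xs (λ _ → 0) ≡ 0
∑-zero []       = refl
∑-zero (x ∷ xs) = ∑-zero xs

∑-+ : (f g : X → ℕ) → ∀ xs → ∑ xs (λ x → f x + g x) ≡ ∑ xs f + ∑ xs g
∑-+ f g []       = refl
∑-+ f g (x ∷ xs) =
  trans (cong (f x + g x +_) (∑-+ f g xs))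
        (interchange +-commutativeSemigroup (f x) (g x) (∑ xs f) (∑ xs g))

∑-++ : (f : X → ℕ) → ∀ xs ys → ∑ (xs ++ ys) f ≡ ∑ xs f + ∑ ys f
∑-++ f xs ys = trans (cong sum (map-++ f xs ys)) (sum-++ (map f xs) (map f ys))

∑-comm : (f : X → Y → ℕ) → ∀ xs ys →
         ∑ xs (λ x → ∑ ys (f x)) ≡ ∑ ys (λ y → ∑ xs (λ x → f x y))
∑-comm f []       ys = sym (∑-zero ys)
∑-comm f (x ∷ xs) ys =
  trans (cong (∑ ys (f x) +_) (∑-comm f xs ys)) (sym (∑-+ (f x) _ ys))

∑-concatMap : (f : Y → ℕ) (g : X → List Y) → ∀ xs →
              ∑ (concatMap g xs) f ≡ ∑ xs (λ x → ∑ (g x) f)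
∑-concatMap f g []       = refl
∑-concatMap f g (x ∷ xs) =
  trans (∑-++ f (g x) (concatMap g xs)) (cong (∑ (g x) f +_) (∑-concatMap f g xs))

count : (X → Bool) → List X → ℕ
count p xs = ∑ xs (λ x → if p x then 1 else 0)

count-cong : {p q : X → Bool} → (∀ x → p x ≡ q x) → ∀ xs → count p xs ≡ count q xs
count-cong p≗q = ∑-cong (λ x → cong (λ b → if b then 1 else 0) (p≗q x))

count-none : {p : X → Bool} → (∀ x → p x ≡ false) → ∀ xs → count p xs ≡ 0
count-none p≗false xs = trans (count-cong p≗false xs) (∑-zero xs)

count-++ : (p : X → Bool) → ∀ xs ys → count p (xs ++ ys) ≡ count p xs + count p ys
count-++ p = ∑-++ _

count-guard : ∀ t (p : X → Bool) xs → count (λ x → t ∧ p x) xs ≡ (if t then count p xs else 0)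
count-guard true  p xs = refl
count-guard false p xs = count-none (λ _ → refl) xs

length-filter≡count : {P : X → Set} (P? : ∀ x → Dec (P x)) → ∀ xs →
                      length (filter P? xs) ≡ count (does ∘ P?) xs
length-filter≡count P? []       = refl
length-filter≡count P? (x ∷ xs) with does (P? x)
... | true  = cong suc (length-filter≡count P? xs)
... | false = length-filter≡count P? xs

count-filter : {P : X → Set} (P? : ∀ x → Dec (P x)) (p : X → Bool) → ∀ xs →
               count p (filter P? xs) ≡ count (λ x → p x ∧ does (P? x)) xs
count-filter P? p []       = refl
count-filter P? p (x ∷ xs) with does (P? x)
... | true  rewrite ∧-identityʳ (p x) = cong (_ +_) (count-filter P? p xs)
... | false rewrite ∧-zeroʳ (p x)     = count-filter P? p xs

bases : List Base
bases = A ∷ C ∷ T ∷ G ∷ []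

∑-bases-select-comp : ∀ b (f : Base → ℕ) →
                      ∑ bases (λ c → if does (b ≟B comp c) then f c else 0) ≡ f (comp b)
∑-bases-select-comp A f = +-identityʳ (f T)
∑-bases-select-comp C f = +-identityʳ (f G)
∑-bases-select-comp T f = +-identityʳ (f A)
∑-bases-select-comp G f = +-identityʳ (f C)

count-stringsOfLength-suc : ∀ p k →
  count p (stringsOfLength (suc k)) ≡ ∑ bases (λ b → count (p ∘ (b ∷_)) (stringsOfLength k))
count-stringsOfLength-suc p k =
  trans (∑-concatMap _ (λ x → map (_∷ x) bases) (stringsOfLength k))
        (∑-comm (λ x b → if p (b ∷ x) then 1 else 0) (stringsOfLength k) bases)

count-stringsOfLength-suc-snoc : ∀ p k →
  count p (stringsOfLength (suc k)) ≡ ∑ bases (λ c → count (p ∘ (_∷ʳ c)) (stringsOfLength k))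
count-stringsOfLength-suc-snoc p 0       = count-stringsOfLength-suc p 0
count-stringsOfLength-suc-snoc p (suc k) = begin
  count p (stringsOfLength (suc (suc k)))
    ≡⟨ count-stringsOfLength-suc p (suc k) ⟩
  ∑ bases (λ b → count (p ∘ (b ∷_)) (stringsOfLength (suc k)))
    ≡⟨ ∑-cong (λ b → count-stringsOfLength-suc-snoc (p ∘ (b ∷_)) k) bases ⟩
  ∑ bases (λ b → ∑ bases (λ c → count (λ z → p (b ∷ (z ∷ʳ c))) (stringsOfLength k)))
    ≡⟨ ∑-comm (λ b c → count (λ z → p (b ∷ (z ∷ʳ c))) (stringsOfLength k)) bases bases ⟩
  ∑ bases (λ c → ∑ bases (λ b → count (λ z → p (b ∷ (z ∷ʳ c))) (stringsOfLength k)))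
    ≡⟨ ∑-cong (λ c → count-stringsOfLength-suc (p ∘ (_∷ʳ c)) k) bases ⟨
  ∑ bases (λ c → count (p ∘ (_∷ʳ c)) (stringsOfLength (suc k)))
    ∎

count-stringsOfLength-2+ : ∀ p k →
  count p (stringsOfLength (2 + k)) ≡
  ∑ bases (λ b → ∑ bases (λ c → count (λ z → p (b ∷ (z ∷ʳ c))) (stringsOfLength k)))
count-stringsOfLength-2+ p k =
  trans (count-stringsOfLength-suc p (suc k))
        (∑-cong (λ b → count-stringsOfLength-suc-snoc (p ∘ (b ∷_)) k) bases)

comp-involutive : ∀ b → comp (comp b) ≡ b
comp-involutive A = refl
comp-involutive C = refl
comp-involutive T = refl
comp-involutive G = refl

bar-cons : ∀ b x → bar (b ∷ x) ≡ bar x ∷ʳ comp b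
bar-cons b x = trans (cong (map comp) (unfold-reverse b x)) (map-++ comp (reverse x) [ b ])

bar-snoc : ∀ x c → bar (x ∷ʳ c) ≡ comp c ∷ bar x
bar-snoc x c = cong (map comp) (reverse-++ x [ c ])

bar-cons-snoc : ∀ b z c → bar (b ∷ (z ∷ʳ c)) ≡ comp c ∷ (bar z ∷ʳ comp b)
bar-cons-snoc b z c = trans (bar-cons b (z ∷ʳ c)) (cong (_∷ʳ comp b) (bar-snoc z c))

selfComplementary? : (x : List Base) → Dec (x ≡ bar x)
selfComplementary? x = ≡-dec _≟B_ x (bar x)

selfComplementaryᵇ : List Base → Bool
selfComplementaryᵇ = does ∘ selfComplementary?

selfComplementary-cons-snoc : ∀ b z c →
  b ∷ (z ∷ʳ c) ≡ bar (b ∷ (z ∷ʳ c)) ⇔ (b ≡ comp c × z ≡ bar z)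
selfComplementary-cons-snoc b z c = mk⇔ to from
  where
  to : b ∷ (z ∷ʳ c) ≡ bar (b ∷ (z ∷ʳ c)) → b ≡ comp c × z ≡ bar z
  to eq with b≡c̄ , z∷ʳc≡z̄∷ʳb̄ ← ∷-injective (trans eq (bar-cons-snoc b z c))
    = b≡c̄ , proj₁ (∷ʳ-injective z (bar z) z∷ʳc≡z̄∷ʳb̄)
  from : b ≡ comp c × z ≡ bar z → b ∷ (z ∷ʳ c) ≡ bar (b ∷ (z ∷ʳ c))
  from (refl , z≡z̄) = sym (trans (bar-cons-snoc (comp c) z c)
    (cong₂ (λ y d → comp c ∷ (y ∷ʳ d)) (sym z≡z̄) (comp-involutive c)))

selfComplementaryᵇ-cons-snoc : ∀ b z c →
  selfComplementaryᵇ (b ∷ (z ∷ʳ c)) ≡ does (b ≟B comp c) ∧ selfComplementaryᵇ z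
selfComplementaryᵇ-cons-snoc b z c =
  does-⇔ (selfComplementary-cons-snoc b z c)
         (selfComplementary? (b ∷ (z ∷ʳ c))) (b ≟B comp c ×-dec selfComplementary? z)

mirror : List Base → List Base
mirror y = y ++ bar y

mirror-cons : ∀ b y → mirror (b ∷ y) ≡ b ∷ (mirror y ∷ʳ comp b)
mirror-cons b y = cong (b ∷_) (begin
  y ++ bar (b ∷ y)       ≡⟨ cong (y ++_) (bar-cons b y) ⟩
  y ++ (bar y ∷ʳ comp b) ≡⟨ ++-assoc y (bar y) [ comp b ] ⟨
  mirror y ∷ʳ comp b     ∎)

weight-++ : ∀ x y → weight (x ++ y) ≡ weight x + weight y
weight-++ []      y = refl
weight-++ (b ∷ x) y = trans (cong (wB b +_) (weight-++ x y)) (sym (+-assoc (wB b) _ _))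

wB-comp : ∀ b → wB (comp b) ≡ wB b
wB-comp A = refl
wB-comp C = refl
wB-comp T = refl
wB-comp G = refl

weight-map-comp : ∀ x → weight (map comp x) ≡ weight x
weight-map-comp []      = refl
weight-map-comp (b ∷ x) = cong₂ _+_ (wB-comp b) (weight-map-comp x)

weight-reverse : ∀ x → weight (reverse x) ≡ weight x
weight-reverse []      = refl
weight-reverse (b ∷ x) = begin
  weight (reverse (b ∷ x))        ≡⟨ cong weight (unfold-reverse b x) ⟩
  weight (reverse x ∷ʳ b)         ≡⟨ weight-++ (reverse x) [ b ] ⟩
  weight (reverse x) + (wB b + 0) ≡⟨ cong₂ _+_ (weight-reverse x) (+-identityʳ (wB b)) ⟩
  weight x + wB b                 ≡⟨ +-comm (weight x) (wB b) ⟩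
  wB b + weight x                 ∎

weight-bar : ∀ x → weight (bar x) ≡ weight x
weight-bar x = trans (weight-map-comp (reverse x)) (weight-reverse x)

weight-mirror : ∀ y → weight (mirror y) ≡ 2 * weight y
weight-mirror y = trans (weight-++ y (bar y))
  (cong (weight y +_) (trans (weight-bar y) (sym (+-identityʳ (weight y)))))

countSelfComplementary : (List Base → Bool) → List (List Base) → ℕ
countSelfComplementary p = count (λ x → selfComplementaryᵇ x ∧ p x)

countSelfComplementary-2+ : ∀ p k →
  countSelfComplementary p (stringsOfLength (2 + k)) ≡
  ∑ bases (λ b → countSelfComplementary (λ z → p (b ∷ (z ∷ʳ comp b))) (stringsOfLength k))
countSelfComplementary-2+ p k = begin
  countSelfComplementary p (stringsOfLength (2 + k))
    ≡⟨ count-stringsOfLength-2+ _ k ⟩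
  ∑ bases (λ b → ∑ bases (λ c →
    count (λ z → selfComplementaryᵇ (b ∷ (z ∷ʳ c)) ∧ p (b ∷ (z ∷ʳ c))) (stringsOfLength k)))
    ≡⟨ ∑-cong (λ b → ∑-cong (peel b) bases) bases ⟩
  ∑ bases (λ b → ∑ bases (λ c → if does (b ≟B comp c)
    then countSelfComplementary (λ z → p (b ∷ (z ∷ʳ c))) (stringsOfLength k) else 0))
    ≡⟨ ∑-cong (λ b → ∑-bases-select-comp b
         (λ c → countSelfComplementary (λ z → p (b ∷ (z ∷ʳ c))) (stringsOfLength k))) bases ⟩
  ∑ bases (λ b → countSelfComplementary (λ z → p (b ∷ (z ∷ʳ comp b))) (stringsOfLength k))
    ∎
  where
  peel : ∀ b c →
    count (λ z → selfComplementaryᵇ (b ∷ (z ∷ʳ c)) ∧ p (b ∷ (z ∷ʳ c))) (stringsOfLength k) ≡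
    (if does (b ≟B comp c)
     then countSelfComplementary (λ z → p (b ∷ (z ∷ʳ c))) (stringsOfLength k) else 0)
  peel b c = trans
    (count-cong (λ z → trans (cong (_∧ p (b ∷ (z ∷ʳ c))) (selfComplementaryᵇ-cons-snoc b z c))
                             (∧-assoc (does (b ≟B comp c)) (selfComplementaryᵇ z) (p (b ∷ (z ∷ʳ c)))))
                (stringsOfLength k))
    (count-guard (does (b ≟B comp c)) _ (stringsOfLength k))

countSelfComplementary-even : ∀ p j →
  countSelfComplementary p (stringsOfLength (2 * j)) ≡ count (p ∘ mirror) (stringsOfLength j)
countSelfComplementary-even p 0       = refl
countSelfComplementary-even p (suc j) = begin
  countSelfComplementary p (stringsOfLength (2 * suc j))
    ≡⟨ cong (countSelfComplementary p ∘ stringsOfLength) (*-suc 2 j) ⟩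
  countSelfComplementary p (stringsOfLength (2 + 2 * j))
    ≡⟨ countSelfComplementary-2+ p (2 * j) ⟩
  ∑ bases (λ b → countSelfComplementary (λ z → p (b ∷ (z ∷ʳ comp b))) (stringsOfLength (2 * j)))
    ≡⟨ ∑-cong (λ b → countSelfComplementary-even (λ z → p (b ∷ (z ∷ʳ comp b))) j) bases ⟩
  ∑ bases (λ b → count (λ y → p (b ∷ (mirror y ∷ʳ comp b))) (stringsOfLength j))
    ≡⟨ ∑-cong (λ b → count-cong (λ y → cong p (mirror-cons b y)) (stringsOfLength j)) bases ⟨
  ∑ bases (λ b → count (λ y → p (mirror (b ∷ y))) (stringsOfLength j))
    ≡⟨ count-stringsOfLength-suc (p ∘ mirror) j ⟨
  count (p ∘ mirror) (stringsOfLength (suc j))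
    ∎

countSelfComplementary-odd : ∀ p j → countSelfComplementary p (stringsOfLength (suc (2 * j))) ≡ 0
countSelfComplementary-odd p 0       = refl
countSelfComplementary-odd p (suc j) = begin
  countSelfComplementary p (stringsOfLength (suc (2 * suc j)))
    ≡⟨ cong (countSelfComplementary p ∘ stringsOfLength ∘ suc) (*-suc 2 j) ⟩
  countSelfComplementary p (stringsOfLength (2 + suc (2 * j)))
    ≡⟨ countSelfComplementary-2+ p (suc (2 * j)) ⟩
  ∑ bases (λ b →
    countSelfComplementary (λ z → p (b ∷ (z ∷ʳ comp b))) (stringsOfLength (suc (2 * j))))
    ≡⟨ ∑-cong (λ b → countSelfComplementary-odd (λ z → p (b ∷ (z ∷ʳ comp b))) j) bases ⟩
  0 ∎

module _ (p : List Base → Bool) where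

  countSelfComplementary-upTo-even : ∀ j →
    countSelfComplementary p (stringsUpTo (2 * j)) ≡ count (p ∘ mirror) (stringsUpTo j)
  countSelfComplementary-upTo-odd : ∀ j →
    countSelfComplementary p (stringsUpTo (suc (2 * j))) ≡ count (p ∘ mirror) (stringsUpTo j)

  countSelfComplementary-upTo-even 0       = countSelfComplementary-even p 0
  countSelfComplementary-upTo-even (suc j) = begin
    countSelfComplementary p (stringsUpTo (2 * suc j))
      ≡⟨ cong (countSelfComplementary p ∘ stringsUpTo) (*-suc 2 j) ⟩
    countSelfComplementary p (stringsUpTo (suc (2 * j)) ++ stringsOfLength (2 + 2 * j))
      ≡⟨ count-++ _ (stringsUpTo (suc (2 * j))) _ ⟩
    countSelfComplementary p (stringsUpTo (suc (2 * j))) +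
    countSelfComplementary p (stringsOfLength (2 + 2 * j))
      ≡⟨ cong₂ _+_ (countSelfComplementary-upTo-odd j) (trans
           (cong (countSelfComplementary p ∘ stringsOfLength) (sym (*-suc 2 j)))
           (countSelfComplementary-even p (suc j))) ⟩
    count (p ∘ mirror) (stringsUpTo j) + count (p ∘ mirror) (stringsOfLength (suc j))
      ≡⟨ count-++ _ (stringsUpTo j) _ ⟨
    count (p ∘ mirror) (stringsUpTo (suc j))
      ∎

  countSelfComplementary-upTo-odd j = begin
    countSelfComplementary p (stringsUpTo (suc (2 * j)))
      ≡⟨ count-++ _ (stringsUpTo (2 * j)) _ ⟩
    countSelfComplementary p (stringsUpTo (2 * j)) +
    countSelfComplementary p (stringsOfLength (suc (2 * j)))
      ≡⟨ cong₂ _+_ (countSelfComplementary-upTo-even j) (countSelfComplementary-odd p j) ⟩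
    count (p ∘ mirror) (stringsUpTo j) + 0
      ≡⟨ +-identityʳ _ ⟩
    count (p ∘ mirror) (stringsUpTo j)
      ∎

hasWeightᵇ : ℕ → List Base → Bool
hasWeightᵇ n x = does (weight x ≟ n)

H≡countSelfComplementary : ∀ n → H n ≡ countSelfComplementary (hasWeightᵇ n) (stringsUpTo n)
H≡countSelfComplementary n =
  trans (length-filter≡count selfComplementary? (stringsOfWeight n))
        (count-filter (λ x → weight x ≟ n) selfComplementaryᵇ (stringsUpTo n))

Gcount≡count : ∀ n → Gcount n ≡ count (hasWeightᵇ n) (stringsUpTo n)
Gcount≡count n = length-filter≡count (λ x → weight x ≟ n) (stringsUpTo n)

hasWeightᵇ-mirror : ∀ m y → hasWeightᵇ (2 * m) (mirror y) ≡ hasWeightᵇ m y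
hasWeightᵇ-mirror m y = does-⇔ (mk⇔ halve double) (weight (mirror y) ≟ 2 * m) (weight y ≟ m)
  where
  halve : weight (mirror y) ≡ 2 * m → weight y ≡ m
  halve e = *-cancelˡ-≡ (weight y) m 2 (trans (sym (weight-mirror y)) e)
  double : weight y ≡ m → weight (mirror y) ≡ 2 * m
  double e = trans (weight-mirror y) (cong (2 *_) e)

hasWeightᵇ-odd-mirror : ∀ k y → hasWeightᵇ (suc (2 * k)) (mirror y) ≡ false
hasWeightᵇ-odd-mirror k y =
  dec-false (weight (mirror y) ≟ suc (2 * k)) (even≢odd (weight y) k ∘ trans (sym (weight-mirror y)))

lemma3 : (∀ k → H (2 * k + 1) ≡ 0) × (∀ k → H (2 * suc k) ≡ Gcount (suc k))
lemma3 = odd , even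
  where
  odd : ∀ k → H (2 * k + 1) ≡ 0
  odd k = begin
    H (2 * k + 1)
      ≡⟨ cong H (+-comm (2 * k) 1) ⟩
    H (suc (2 * k))
      ≡⟨ H≡countSelfComplementary (suc (2 * k)) ⟩
    countSelfComplementary (hasWeightᵇ (suc (2 * k))) (stringsUpTo (suc (2 * k)))
      ≡⟨ countSelfComplementary-upTo-odd (hasWeightᵇ (suc (2 * k))) k ⟩
    count (hasWeightᵇ (suc (2 * k)) ∘ mirror) (stringsUpTo k)
      ≡⟨ count-none (hasWeightᵇ-odd-mirror k) (stringsUpTo k) ⟩
    0 ∎

  even : ∀ k → H (2 * suc k) ≡ Gcount (suc k)
  even k = begin
    H (2 * suc k)
      ≡⟨ H≡countSelfComplementary (2 * suc k) ⟩
    countSelfComplementary (hasWeightᵇ (2 * suc k)) (stringsUpTo (2 * suc k))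
      ≡⟨ countSelfComplementary-upTo-even (hasWeightᵇ (2 * suc k)) (suc k) ⟩
    count (hasWeightᵇ (2 * suc k) ∘ mirror) (stringsUpTo (suc k))
      ≡⟨ count-cong (hasWeightᵇ-mirror (suc k)) (stringsUpTo (suc k)) ⟩
    count (hasWeightᵇ (suc k)) (stringsUpTo (suc k))
      ≡⟨ Gcount≡count (suc k) ⟨
    Gcount (suc k) ∎
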